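{- Let $\mathrm{m}$ be a rooted bipartite plane map, let $d_1\geq d_2\geq\Delta_\circ(\mathrm{m})$, and let $\mathcal{O}_1$ and $\mathcal{O}_2$ be the minimal $\alpha_{d_1}$-orientation and the minimal $\alpha_{d_2}$-orientation of $\mathrm{m}$ respectively. Then for every half-edge $h$, \[ \mathcal{O}_1(h)=\begin{cases}\mathcal{O}_2(h) & \text{if } h \text{ is incident to a white vertex},\\ \mathcal{O}_2(h)+(d_1-d_2) & \text{if } h \text{ is incident to a black vertex}.\end{cases} \]
   Context: A plane map is a planar map with a marked outer face; rooted means a distinguished corner. Bipartite maps carry a fixed proper black/white vertex coloring; $\Delta_\circ(\mathrm{m})$ is the maximal degree of a white vertex. A $k$-fractional orientation assigns to each half-edge a value in $\mathbb{Z}_{\ge0}$ with the two half-edges of each edge summing to $k$; the outdegree of $v$ is the sum of the values of its half-edges. An $\alpha_d$-orientation ($d\ge1$) is a $(d+1)$-fractional orientation with outdegree $d\deg(v)$ at black vertices and $\deg(v)$ at white vertices. A directed edge $(h_1,h_2)$ is forward if $\mathcal{O}(h_1)>0$; a forward cycle is a cycle of forward directed edges; it is counterclockwise if the outer face lies on its right. An orientation is minimal if it has no counterclockwise forward cycle. Every bipartite plane map admits a unique minimal $\alpha_d$-orientation for each $d\ge1$. -}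

module Defs where

open import Data.Nat using (ℕ; zero; suc; _+_; _*_; _≤_; _<_)
open import Data.Nat.ListAction using (sum)
open import Data.Fin using (Fin; zero; suc; inject₁; fromℕ) renaming (_≟_ to _≟ᶠ_)
open import Data.List using (List; map; allFin)
open import Data.Bool using (Bool; true; false; if_then_else_)
open import Data.Product using (Σ; ∃; _×_; _,_)
open import Relation.Nullary using (¬_; does)
open import Relation.Binary.PropositionalEquality using (_≡_; _≢_)
open import Function using (_∘_)
open import Data.Sum using (_⊎_)

iter : {A : Set} → (A → A) → ℕ → A → A
iter f zero    x = x
iter f (suc k) x = f (iter f k x)

InOrbit : {A : Set} → (A → A) → A → A → Set
InOrbit f x y = ∃ λ k → iter f k x ≡ y

-- Reachability in the group generated by α and σ (σ a permutation, α an involution,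
-- so forward steps suffice on a finite set).
data Reach {n : ℕ} (α σ : Fin n → Fin n) (x : Fin n) : Fin n → Set where
  here  : Reach α σ x x
  stepα : ∀ {y} → Reach α σ x y → Reach α σ x (α y)
  stepσ : ∀ {y} → Reach α σ x y → Reach α σ x (σ y)

-- A plane map in the combinatorial (rotation system) encoding.
-- Half-edges are Fin nH.  α pairs the two half-edges of each edge,
-- σ is the counterclockwise rotation around vertices, and the faces are
-- the orbits of φ = σ ∘ α ; with these conventions the face containing h
-- is the face lying to the right of the directed edge (h, α h).
-- Planarity (genus 0) of the connected map: Euler's formula V - E + F = 2
-- with E = nH / 2, i.e. 2V + 2F = nH + 4.
record PlaneMap : Set where
  field
    nH nV nF : ℕ
    α σ σ⁻¹  : Fin nH → Fin nH
    α-invol  : ∀ h → α (α h) ≡ h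
    α-nofix  : ∀ h → α h ≢ h
    σ-inv₁   : ∀ h → σ (σ⁻¹ h) ≡ h
    σ-inv₂   : ∀ h → σ⁻¹ (σ h) ≡ h
    connected : ∀ h h' → Reach α σ h h'
    vert     : Fin nH → Fin nV
    vert-surj : ∀ v → ∃ λ h → vert h ≡ v
    vert-orb₁ : ∀ h h' → vert h ≡ vert h' → InOrbit σ h h'
    vert-orb₂ : ∀ h h' → InOrbit σ h h' → vert h ≡ vert h'
    face     : Fin nH → Fin nF
    face-surj : ∀ f → ∃ λ h → face h ≡ f
    face-orb₁ : ∀ h h' → face h ≡ face h' → InOrbit (σ ∘ α) h h'
    face-orb₂ : ∀ h h' → InOrbit (σ ∘ α) h h' → face h ≡ face h'
    euler    : 2 * nV + 2 * nF ≡ nH + 4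
    outer    : Fin nF

-- A rooted plane map: a distinguished corner, encoded by a half-edge
-- (the corner following it counterclockwise around its vertex).
record RootedPlaneMap : Set where
  field
    pmap : PlaneMap
    root : Fin (PlaneMap.nH pmap)
  open PlaneMap pmap public

-- Bipartite map with a fixed proper colouring (true = white, false = black).
record RootedBipartitePlaneMap : Set where
  field
    rmap   : RootedPlaneMap
  open RootedPlaneMap rmap public
  field
    white  : Fin nV → Bool
    proper : ∀ h → white (vert h) ≢ white (vert (α h))

module _ (m : RootedBipartitePlaneMap) where
  open RootedBipartitePlaneMap m

  sumAt : (Fin nH → ℕ) → Fin nV → ℕ
  sumAt g v = sum (map (λ h → if does (vert h ≟ᶠ v) then g h else 0) (allFin nH))

  deg : Fin nV → ℕ
  deg = sumAt (λ _ → 1)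

  MaxWhiteDegLE : ℕ → Set
  MaxWhiteDegLE D = ∀ v → white v ≡ true → deg v ≤ D

  IsFracOrientation : ℕ → (Fin nH → ℕ) → Set
  IsFracOrientation k O = ∀ h → O h + O (α h) ≡ k

  outdeg : (Fin nH → ℕ) → Fin nV → ℕ
  outdeg O = sumAt O

  IsAlphaOrientation : ℕ → (Fin nH → ℕ) → Set
  IsAlphaOrientation d O =
    IsFracOrientation (suc d) O ×
    (∀ v → white v ≡ false → outdeg O v ≡ d * deg v) ×
    (∀ v → white v ≡ true  → outdeg O v ≡ deg v)

  -- A (simple) cycle of length suc k, given by the half-edges c i at which
  -- its directed edges (c i , α (c i)) start.
  record Cycle (k : ℕ) (c : Fin (suc k) → Fin nH) : Set where
    field
      closes-step : ∀ (i : Fin k) → vert (α (c (inject₁ i))) ≡ vert (c (suc i))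
      closes-last : vert (α (c (fromℕ k))) ≡ vert (c zero)
      distinct-vertices : ∀ i j → vert (c i) ≡ vert (c j) → i ≡ j
      distinct-edges    : ∀ i j → i ≢ j → c i ≢ α (c j)

  OnCycle : ∀ {k} → (Fin (suc k) → Fin nH) → Fin nH → Set
  OnCycle c e = ∃ λ i → (e ≡ c i) ⊎ (e ≡ α (c i))

  -- faces lying on the right side of the directed cycle c: the faces to the
  -- right of its directed edges, closed under adjacency across edges not on c
  data RightFace {k : ℕ} (c : Fin (suc k) → Fin nH) : Fin nF → Set where
    base : ∀ i → RightFace c (face (c i))
    step : ∀ e → RightFace c (face e) → ¬ OnCycle c e → RightFace c (face (α e))

  ForwardCycle : (Fin nH → ℕ) → (k : ℕ) → (Fin (suc k) → Fin nH) → Set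
  ForwardCycle O k c = Cycle k c × (∀ i → 0 < O (c i))

  CounterClockwise : ∀ {k} → (Fin (suc k) → Fin nH) → Set
  CounterClockwise c = RightFace c outer

  IsMinimal : (Fin nH → ℕ) → Set
  IsMinimal O = ∀ k c → ForwardCycle O k c → ¬ CounterClockwise c

  IsMinimalAlphaOrientation : ℕ → (Fin nH → ℕ) → Set
  IsMinimalAlphaOrientation d O = IsAlphaOrientation d O × IsMinimal O

-- Shift the α_{d₂}-orientation O₂ by d₁ − d₂ on every half-edge at a black vertex. The result T is
-- an α_{d₁}-orientation; if T ≠ O₁, then from a half-edge with T < O₁ one can always continue along
-- a half-edge with T < O₁ at the far end (outdegrees agree), so such half-edges contain a cycle.
-- It is forward for O₁, and its reversal is forward for O₂ (this is where Δ∘(m) ≤ d₂ is used).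
-- By connectivity the outer face lies to the right of the cycle or of its reversal, contradicting
-- the minimality of O₁ or of O₂. Hence O₁ = T.
module Submission where

open import Defs
open import Data.Nat using (ℕ; zero; suc; _+_; _*_; _∸_; _≤_; _<_; z≤n; s≤s; _<?_)
open import Data.Nat.Properties
open import Data.Nat.ListAction using (sum)
open import Data.Nat.Solver using (module +-*-Solver)
open import Data.Fin using (Fin; toℕ; fromℕ<; opposite) renaming (_≟_ to _≟ᶠ_; zero to fzero)
open import Data.Fin.Properties
  using (any?; pigeonhole; toℕ-injective; toℕ-fromℕ<; toℕ-inject₁; toℕ-fromℕ; toℕ<n; toℕ≤pred[n]; opposite-prop)
open import Data.List using (List; []; _∷_; map; allFin)
open import Data.List.Properties using (map-cong)
open import Data.List.Membership.Propositional using (_∈_)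
open import Data.List.Membership.Propositional.Properties using (∈-allFin)
open import Data.List.Relation.Unary.Any using (here; there)
open import Data.Bool using (Bool; true; false; if_then_else_)
open import Data.Product using (∃; ∃₂; _×_; _,_; proj₁; proj₂)
open import Data.Sum using (_⊎_; inj₁; inj₂)
open import Data.Empty using (⊥)
open import Relation.Nullary using (¬_; yes; no; does; contradiction)
open import Relation.Nullary.Decidable using (_×-dec_; _⊎-dec_)
open import Relation.Binary.PropositionalEquality
  using (_≡_; _≢_; refl; sym; trans; cong; cong₂; subst; subst₂; module ≡-Reasoning)
open import Function using (_∘_)
open import Algebra.Properties.CommutativeSemigroup +-commutativeSemigroup using (interchange)

<-complement : ∀ {a b c d} → a + b ≡ c + d → a < c → d < b
<-complement {a} {b} {c} {d} eq a<c with d <? b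
... | yes d<b = d<b
... | no d≮b = contradiction eq (<⇒≢ (+-mono-<-≤ a<c (≮⇒≥ d≮b)))

module _ {A : Set} where

  sum-map-mono-≤ : {f g : A → ℕ} → (∀ x → f x ≤ g x) → ∀ xs → sum (map f xs) ≤ sum (map g xs)
  sum-map-mono-≤ f≤g []       = z≤n
  sum-map-mono-≤ f≤g (x ∷ xs) = +-mono-≤ (f≤g x) (sum-map-mono-≤ f≤g xs)

  sum-map-mono-< : {f g : A → ℕ} → (∀ x → f x ≤ g x) →
    ∀ {x xs} → x ∈ xs → f x < g x → sum (map f xs) < sum (map g xs)
  sum-map-mono-< f≤g {xs = _ ∷ xs} (here refl) fx<gx = +-mono-<-≤ fx<gx (sum-map-mono-≤ f≤g xs)
  sum-map-mono-< f≤g {xs = y ∷ _} (there x∈xs) fx<gx = +-mono-≤-< (f≤g y) (sum-map-mono-< f≤g x∈xs fx<gx)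

  ≤-sum-map : (f : A → ℕ) → ∀ {x xs} → x ∈ xs → f x ≤ sum (map f xs)
  ≤-sum-map f {xs = y ∷ xs} (here refl)  = m≤m+n (f y) _
  ≤-sum-map f {xs = y ∷ xs} (there x∈xs) = ≤-trans (≤-sum-map f x∈xs) (m≤n+m _ (f y))

  sum-map-if-+ : (b : A → Bool) (f : A → ℕ) (c : ℕ) (xs : List A) →
    sum (map (λ x → if b x then f x + c else 0) xs) ≡
      sum (map (λ x → if b x then f x else 0) xs) + c * sum (map (λ x → if b x then 1 else 0) xs)
  sum-map-if-+ b f c [] = sym (*-zeroʳ c)
  sum-map-if-+ b f c (x ∷ xs) with b x
  ... | false = sum-map-if-+ b f c xs
  ... | true rewrite sum-map-if-+ b f c xs = regroup (f x) c _ _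
    where
    open +-*-Solver
    regroup : ∀ a c s t → a + c + (s + c * t) ≡ a + s + c * suc t
    regroup = solve 4 (λ a c s t → a :+ c :+ (s :+ c :* t) := a :+ s :+ c :* (con 1 :+ t)) refl

module _ {n : ℕ} (f : ℕ → Fin n) where

  InjectiveBelow : ℕ → Set
  InjectiveBelow j = ∀ {a b} → a < j → b < j → f a ≡ f b → a ≡ b

  ReturningSegment : Set
  ReturningSegment = ∃₂ λ i k →
    f (i + suc k) ≡ f i × (∀ {a b} → a ≤ k → b ≤ k → f (i + a) ≡ f (i + b) → a ≡ b)

  injectiveBelow⊎returningSegment : ∀ j → InjectiveBelow j ⊎ ReturningSegment
  injectiveBelow⊎returningSegment zero = inj₁ (λ ())
  injectiveBelow⊎returningSegment (suc j) with injectiveBelow⊎returningSegment j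
  ... | inj₂ segment = inj₂ segment
  ... | inj₁ injective with any? (λ (i : Fin j) → f j ≟ᶠ f (toℕ i))
  ...   | yes (i , fj≡fi) = inj₂ (toℕ i , k , trans (cong f i+1+k≡j) fj≡fi , distinct)
    where
    k = j ∸ suc (toℕ i)
    i+1+k≡j : toℕ i + suc k ≡ j
    i+1+k≡j = trans (+-suc (toℕ i) k) (m+[n∸m]≡n (toℕ<n i))
    inSegment : ∀ {a} → a ≤ k → toℕ i + a < j
    inSegment {a} a≤k = subst (toℕ i + a <_) i+1+k≡j (+-monoʳ-< (toℕ i) (s≤s a≤k))
    distinct : ∀ {a b} → a ≤ k → b ≤ k → f (toℕ i + a) ≡ f (toℕ i + b) → a ≡ b
    distinct a≤k b≤k eq = +-cancelˡ-≡ (toℕ i) _ _ (injective (inSegment a≤k) (inSegment b≤k) eq)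
  ...   | no noEarlier = inj₁ λ a<1+j b<1+j → extend (m<1+n⇒m<n∨m≡n a<1+j) (m<1+n⇒m<n∨m≡n b<1+j)
    where
    earlier : ∀ {b} → b < j → f j ≢ f b
    earlier b<j eq = noEarlier (fromℕ< b<j , trans eq (cong f (sym (toℕ-fromℕ< b<j))))
    extend : ∀ {a b} → a < j ⊎ a ≡ j → b < j ⊎ b ≡ j → f a ≡ f b → a ≡ b
    extend (inj₁ a<j)  (inj₁ b<j)  eq = injective a<j b<j eq
    extend (inj₁ a<j)  (inj₂ refl) eq = contradiction (sym eq) (earlier a<j)
    extend (inj₂ refl) (inj₁ b<j)  eq = contradiction eq (earlier b<j)
    extend (inj₂ refl) (inj₂ refl) eq = refl

  returningSegment : ReturningSegment
  returningSegment with injectiveBelow⊎returningSegment (suc n)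
  ... | inj₂ segment = segment
  ... | inj₁ injective with pigeonhole (n<1+n n) (f ∘ toℕ)
  ...   | i , j , i<j , eq = contradiction (injective (toℕ<n i) (toℕ<n j) eq) (<⇒≢ i<j)

module _ (m : RootedBipartitePlaneMap) where
  open RootedBipartitePlaneMap m

  selectAt : (Fin nH → ℕ) → Fin nV → Fin nH → ℕ
  selectAt g v h = if does (vert h ≟ᶠ v) then g h else 0

  selectAt-self : ∀ g {h v} → vert h ≡ v → selectAt g v h ≡ g h
  selectAt-self g {h} {v} at-v with vert h ≟ᶠ v
  ... | yes _  = refl
  ... | no neq = contradiction at-v neq

  ≤-sumAt : (g : Fin nH → ℕ) → ∀ {h v} → vert h ≡ v → g h ≤ sumAt m g v
  ≤-sumAt g {h} {v} at-v = subst (_≤ sumAt m g v) (selectAt-self g at-v) (≤-sum-map (selectAt g v) (∈-allFin h))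

  sumAt-+-const : (f g : Fin nH → ℕ) (c : ℕ) → ∀ v →
    (∀ h → vert h ≡ v → g h ≡ f h + c) → sumAt m g v ≡ sumAt m f v + c * deg m v
  sumAt-+-const f g c v g≡f+c =
    trans (cong sum (map-cong pointwise (allFin nH)))
          (sum-map-if-+ (λ h → does (vert h ≟ᶠ v)) f c (allFin nH))
    where
    pointwise : ∀ h → selectAt g v h ≡ selectAt (λ h' → f h' + c) v h
    pointwise h with vert h ≟ᶠ v
    ... | yes at-v = g≡f+c h at-v
    ... | no _     = refl

  sumAt-≡-compensate : (f g : Fin nH → ℕ) → ∀ {v h} → sumAt m f v ≡ sumAt m g v →
    vert h ≡ v → f h < g h → ∃ λ h' → vert h' ≡ v × g h' < f h'
  sumAt-≡-compensate f g {v} {h} sums-equal at-v fh<gh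
    with any? (λ h' → (vert h' ≟ᶠ v) ×-dec (g h' <? f h'))
  ... | yes found = found
  ... | no none = contradiction sums-equal (<⇒≢ (sum-map-mono-< selected-≤ (∈-allFin h) selected-<))
    where
    selected-≤ : ∀ h' → selectAt f v h' ≤ selectAt g v h'
    selected-≤ h' with vert h' ≟ᶠ v
    ... | yes at-v' = ≮⇒≥ (λ gh'<fh' → none (h' , at-v' , gh'<fh'))
    ... | no _      = z≤n
    selected-< : selectAt f v h < selectAt g v h
    selected-< = subst₂ _<_ (sym (selectAt-self f at-v)) (sym (selectAt-self g at-v)) fh<gh

  -- the ℕ-indexed counterpart of Cycle, convenient for reindexing
  record ClosedTrail (k : ℕ) (z : ℕ → Fin nH) : Set where
    field
      steps  : ∀ t → t < k → vert (α (z t)) ≡ vert (z (suc t))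
      closes : vert (α (z k)) ≡ vert (z 0)
      distinct-vertices : ∀ {t t'} → t ≤ k → t' ≤ k → vert (z t) ≡ vert (z t') → t ≡ t'
      distinct-edges    : ∀ {t t'} → t ≤ k → t' ≤ k → z t ≢ α (z t')

  closedTrail⇒cycle : ∀ {k z} → ClosedTrail k z → Cycle m k (λ i → z (toℕ i))
  closedTrail⇒cycle {k} {z} trail = record
    { closes-step = λ i → subst (λ u → vert (α (z u)) ≡ vert (z (suc (toℕ i))))
                                (sym (toℕ-inject₁ i)) (steps (toℕ i) (toℕ<n i))
    ; closes-last = subst (λ u → vert (α (z u)) ≡ vert (z 0)) (sym (toℕ-fromℕ k)) closes
    ; distinct-vertices = λ i j eq → toℕ-injective (distinct-vertices (toℕ≤pred[n] i) (toℕ≤pred[n] j) eq)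
    ; distinct-edges = λ i j _ → distinct-edges (toℕ≤pred[n] i) (toℕ≤pred[n] j)
    }
    where open ClosedTrail trail

  reverseTrail : ℕ → (ℕ → Fin nH) → ℕ → Fin nH
  reverseTrail k z t = α (z (k ∸ t))

  closedTrail-reverse : ∀ {k z} → ClosedTrail k z → ClosedTrail k (reverseTrail k z)
  closedTrail-reverse {k} {z} trail = record
    { steps = reversed-steps
    ; closes = trans (cong vert (α-invol _)) (trans (cong (vert ∘ z) (n∸n≡0 k)) (sym closes))
    ; distinct-vertices = λ {t} {t'} t≤k t'≤k eq →
        ∸-cancelˡ-≡ t≤k t'≤k (ends-distinct (m∸n≤m k t) (m∸n≤m k t') eq)
    ; distinct-edges = λ {t} {t'} _ _ eq →
        distinct-edges (m∸n≤m k t') (m∸n≤m k t) (sym (trans eq (α-invol _)))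
    }
    where
    open ClosedTrail trail
    open ≡-Reasoning

    reversed-steps : ∀ t → t < k → vert (α (reverseTrail k z t)) ≡ vert (reverseTrail k z (suc t))
    reversed-steps t t<k = begin
      vert (α (α (z (k ∸ t))))     ≡⟨ cong vert (α-invol _) ⟩
      vert (z (k ∸ t))             ≡⟨ cong (vert ∘ z) k∸t≡1+k∸[1+t] ⟩
      vert (z (suc (k ∸ suc t)))   ≡⟨ sym (steps (k ∸ suc t) k∸[1+t]<k) ⟩
      vert (α (z (k ∸ suc t)))     ∎
      where
      k∸t≡1+k∸[1+t] : k ∸ t ≡ suc (k ∸ suc t)
      k∸t≡1+k∸[1+t] = +-∸-assoc 1 t<k
      k∸[1+t]<k : k ∸ suc t < k
      k∸[1+t]<k = subst (_≤ k) k∸t≡1+k∸[1+t] (m∸n≤m k t)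

    ends-distinct : ∀ {a b} → a ≤ k → b ≤ k → vert (α (z a)) ≡ vert (α (z b)) → a ≡ b
    ends-distinct {a} {b} a≤k b≤k eq with m≤n⇒m<n∨m≡n a≤k | m≤n⇒m<n∨m≡n b≤k
    ... | inj₁ a<k  | inj₁ b<k  =
      suc-injective (distinct-vertices a<k b<k (trans (sym (steps a a<k)) (trans eq (steps b b<k))))
    ... | inj₁ a<k  | inj₂ refl =
      contradiction (distinct-vertices a<k z≤n (trans (sym (steps a a<k)) (trans eq closes))) λ ()
    ... | inj₂ refl | inj₁ b<k  =
      contradiction (distinct-vertices b<k z≤n (trans (sym (steps b b<k)) (trans (sym eq) closes))) λ ()
    ... | inj₂ refl | inj₂ refl = refl

  Reverses : ∀ {k} → (c r : Fin (suc k) → Fin nH) → Set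
  Reverses c r = (∀ i → ∃ λ j → r j ≡ α (c i)) × (∀ j → ∃ λ i → r j ≡ α (c i))

  reverseTrail-reverses : ∀ k z → Reverses (λ i → z (toℕ i)) (λ i → reverseTrail k z (toℕ i))
  reverseTrail-reverses k z =
      (λ i → opposite i , cong (α ∘ z) (trans (cong (k ∸_) (opposite-prop i)) (m∸[m∸n]≡n (toℕ≤pred[n] i))))
    , (λ j → opposite j , cong (α ∘ z) (sym (opposite-prop j)))

  onCycle-reverse : ∀ {k} {c r : Fin (suc k) → Fin nH} → Reverses c r → ∀ {e} → OnCycle m r e → OnCycle m c e
  onCycle-reverse (_ , r-from-c) (j , inj₁ e≡rj) with r-from-c j
  ... | i , rj≡αci = i , inj₂ (trans e≡rj rj≡αci)
  onCycle-reverse (_ , r-from-c) (j , inj₂ e≡αrj) with r-from-c j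
  ... | i , rj≡αci = i , inj₁ (trans e≡αrj (trans (cong α rj≡αci) (α-invol _)))

  -- Crossing an edge of c from either side lands on a face to the right of c or of r, and crossing
  -- any other edge keeps the side; by connectivity every face is on one of the two sides.
  rightFace-⊎-reverse : ∀ {k} {c r : Fin (suc k) → Fin nH} → Reverses c r →
    ∀ f → RightFace m c f ⊎ RightFace m r f
  rightFace-⊎-reverse {k} {c} {r} c↔r f with face-surj f
  ... | h , refl = reachable h (connected (c fzero) h)
    where
    SideOf : Fin nF → Set
    SideOf f = RightFace m c f ⊎ RightFace m r f

    Side : Fin nH → Set
    Side h = SideOf (face h)

    cross : ∀ h → Side h → Side (α h)
    cross h side with any? (λ i → (h ≟ᶠ c i) ⊎-dec (h ≟ᶠ α (c i)))
    cross h (inj₁ R) | no off = inj₁ (step h R off)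
    cross h (inj₂ R) | no off = inj₂ (step h R (off ∘ onCycle-reverse c↔r))
    cross h side | yes (i , inj₁ refl) with proj₁ c↔r i
    ... | j , rj≡αci = inj₂ (subst (RightFace m r) (cong face rj≡αci) (base j))
    cross h side | yes (i , inj₂ refl) = inj₁ (subst (RightFace m c) (cong face (sym (α-invol _))) (base i))

    reachable : ∀ h → Reach α σ (c fzero) h → Side h
    reachable _ here = inj₁ (base fzero)
    reachable _ (stepα {h} R) = cross h (reachable h R)
    reachable _ (stepσ {h} R) =
      subst SideOf (face-orb₂ (α h) (σ h) (1 , cong σ (α-invol h))) (cross h (reachable h R))

  closedTrail-in-walk : (P : Fin nH → Set) → (∀ {h} → P h → ¬ P (α h)) →
    (z : ℕ → Fin nH) → (∀ t → P (z t)) → (∀ t → vert (α (z t)) ≡ vert (z (suc t))) →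
    ∃₂ λ k w → ClosedTrail k w × ∀ t → P (w t)
  closedTrail-in-walk P P⇒¬Pα z Pz walks with returningSegment (vert ∘ z)
  ... | i , k , returns , distinct = k , (λ t → z (i + t)) , trail , (λ t → Pz (i + t))
    where
    trail : ClosedTrail k (λ t → z (i + t))
    trail = record
      { steps = λ t _ → subst (λ u → vert (α (z (i + t))) ≡ vert (z u)) (sym (+-suc i t)) (walks (i + t))
      ; closes = trans (walks (i + k))
                   (trans (cong (vert ∘ z) (sym (+-suc i k)))
                     (trans returns (cong (vert ∘ z) (sym (+-identityʳ i)))))
      ; distinct-vertices = distinct
      ; distinct-edges = λ {t} {t'} _ _ eq → P⇒¬Pα (Pz (i + t')) (subst P eq (Pz (i + t)))
      }

  module CompareOrientations {k : ℕ} {O O' : Fin nH → ℕ}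
    (O-frac : IsFracOrientation m k O) (O'-frac : IsFracOrientation m k O')
    (same-outdeg : ∀ v → outdeg m O v ≡ outdeg m O' v) where

    Excess : Fin nH → Set
    Excess h = O' h < O h

    excess⇒deficit-α : ∀ {h} → Excess h → O (α h) < O' (α h)
    excess⇒deficit-α {h} = <-complement (trans (O'-frac h) (sym (O-frac h)))

    deficit⇒excess-α : ∀ {h} → O h < O' h → Excess (α h)
    deficit⇒excess-α {h} = <-complement (trans (O-frac h) (sym (O'-frac h)))

    excess-continues : ∀ {h} → Excess h → ∃ λ h' → vert h' ≡ vert (α h) × Excess h'
    excess-continues {h} excess =
      sumAt-≡-compensate O O' (same-outdeg (vert (α h))) refl (excess⇒deficit-α excess)

    excess-closedTrail : ∀ {h} → Excess h → ∃₂ λ n z → ClosedTrail n z × ∀ t → Excess (z t)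
    excess-closedTrail {h} excess =
      closedTrail-in-walk Excess (<-asym ∘ excess⇒deficit-α) (proj₁ ∘ walk) (proj₂ ∘ walk)
        (λ t → sym (proj₁ (proj₂ (excess-continues (proj₂ (walk t))))))
      where
      walk : ℕ → ∃ Excess
      walk zero    = h , excess
      walk (suc t) = proj₁ next , proj₂ (proj₂ next)
        where next = excess-continues (proj₂ (walk t))

  minimal⇒¬forward-and-reverse : ∀ {O O'} → IsMinimal m O → IsMinimal m O' → ∀ {k z} → ClosedTrail k z →
    (∀ t → 0 < O (z t)) → (∀ t → 0 < O' (reverseTrail k z t)) → ⊥
  minimal⇒¬forward-and-reverse O-min O'-min {k} {z} trail forward reverse-forward
    with rightFace-⊎-reverse (reverseTrail-reverses k z) outer
  ... | inj₁ ccw = O-min k _ (closedTrail⇒cycle trail , forward ∘ toℕ) ccw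
  ... | inj₂ ccw = O'-min k _ (closedTrail⇒cycle (closedTrail-reverse trail) , reverse-forward ∘ toℕ) ccw

  alpha-same-outdeg : ∀ {d O O'} → IsAlphaOrientation m d O → IsAlphaOrientation m d O' →
    ∀ v → outdeg m O v ≡ outdeg m O' v
  alpha-same-outdeg (_ , black , white') (_ , black' , white'') v with white v in colour
  ... | true  = trans (white' v colour) (sym (white'' v colour))
  ... | false = trans (black v colour) (sym (black' v colour))

  alpha-positive-opposite-white : ∀ {d O} → IsAlphaOrientation m d O → MaxWhiteDegLE m d →
    ∀ h → white (vert h) ≡ true → 0 < O (α h)
  alpha-positive-opposite-white {d} {O} (frac , _ , white-outdeg) Δ∘≤d h is-white =
    <-complement (trans (frac h) (sym (+-identityʳ (suc d)))) (s≤s Oh≤d)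
    where
    Oh≤d : O h ≤ d
    Oh≤d = ≤-trans (≤-sumAt O refl)
             (≤-trans (≤-reflexive (white-outdeg (vert h) is-white)) (Δ∘≤d (vert h) is-white))

module Shifted (m : RootedBipartitePlaneMap) (d₁ d₂ : ℕ) (d₂≤d₁ : d₂ ≤ d₁)
  (O₂ : Fin (RootedBipartitePlaneMap.nH m) → ℕ) (O₂-alpha : IsAlphaOrientation m d₂ O₂) where
  open RootedBipartitePlaneMap m

  shift : Bool → ℕ
  shift isWhite = if isWhite then 0 else d₁ ∸ d₂

  shifted : Fin nH → ℕ
  shifted h = O₂ h + shift (white (vert h))

  shift-edge : ∀ h → shift (white (vert h)) + shift (white (vert (α h))) ≡ d₁ ∸ d₂
  shift-edge h with white (vert h) in e₁ | white (vert (α h)) in e₂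
  ... | true  | true  = contradiction (trans e₁ (sym e₂)) (proper h)
  ... | false | false = contradiction (trans e₁ (sym e₂)) (proper h)
  ... | true  | false = refl
  ... | false | true  = +-identityʳ _

  shifted-alpha : IsAlphaOrientation m d₁ shifted
  shifted-alpha = frac , black , white'
    where
    open ≡-Reasoning
    frac : IsFracOrientation m (suc d₁) shifted
    frac h = begin
      (O₂ h + sₕ) + (O₂ (α h) + sₐ)  ≡⟨ interchange (O₂ h) sₕ (O₂ (α h)) sₐ ⟩
      (O₂ h + O₂ (α h)) + (sₕ + sₐ)  ≡⟨ cong₂ _+_ (proj₁ O₂-alpha h) (shift-edge h) ⟩
      suc d₂ + (d₁ ∸ d₂)             ≡⟨ cong suc (m+[n∸m]≡n d₂≤d₁) ⟩
      suc d₁                         ∎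
      where
      sₕ = shift (white (vert h))
      sₐ = shift (white (vert (α h)))

    outdeg-shifted : ∀ v → outdeg m shifted v ≡ outdeg m O₂ v + shift (white v) * deg m v
    outdeg-shifted v = sumAt-+-const m O₂ shifted (shift (white v)) v
                         (λ h at-v → cong (λ u → O₂ h + shift (white u)) at-v)

    black : ∀ v → white v ≡ false → outdeg m shifted v ≡ d₁ * deg m v
    black v is-black = begin
      outdeg m shifted v                             ≡⟨ outdeg-shifted v ⟩
      outdeg m O₂ v + shift (white v) * deg m v      ≡⟨ cong (λ w → outdeg m O₂ v + shift w * deg m v) is-black ⟩
      outdeg m O₂ v + (d₁ ∸ d₂) * deg m v            ≡⟨ cong (_+ _) (proj₁ (proj₂ O₂-alpha) v is-black) ⟩
      d₂ * deg m v + (d₁ ∸ d₂) * deg m v             ≡⟨ sym (*-distribʳ-+ (deg m v) d₂ _) ⟩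
      (d₂ + (d₁ ∸ d₂)) * deg m v                     ≡⟨ cong (_* deg m v) (m+[n∸m]≡n d₂≤d₁) ⟩
      d₁ * deg m v                                   ∎

    white' : ∀ v → white v ≡ true → outdeg m shifted v ≡ deg m v
    white' v is-white = begin
      outdeg m shifted v                             ≡⟨ outdeg-shifted v ⟩
      outdeg m O₂ v + shift (white v) * deg m v      ≡⟨ cong (λ w → outdeg m O₂ v + shift w * deg m v) is-white ⟩
      outdeg m O₂ v + 0                              ≡⟨ +-identityʳ _ ⟩
      outdeg m O₂ v                                  ≡⟨ proj₂ (proj₂ O₂-alpha) v is-white ⟩
      deg m v                                        ∎

  shifted-positive⇒positive : MaxWhiteDegLE m d₂ → ∀ h → 0 < shifted h → 0 < O₂ h
  shifted-positive⇒positive Δ∘≤d₂ h positive with white (vert h) in colour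
  ... | true  = subst (0 <_) (+-identityʳ (O₂ h)) positive
  ... | false = subst (λ h' → 0 < O₂ h') (α-invol h)
                  (alpha-positive-opposite-white m O₂-alpha Δ∘≤d₂ (α h) αh-white)
    where
    αh-white : white (vert (α h)) ≡ true
    αh-white with white (vert (α h)) in colour'
    ... | true  = refl
    ... | false = contradiction (trans colour (sym colour')) (proper h)

  minimal≡shifted : ∀ {O₁} → IsMinimalAlphaOrientation m d₁ O₁ → IsMinimal m O₂ → MaxWhiteDegLE m d₂ →
    ∀ h → O₁ h ≡ shifted h
  minimal≡shifted {O₁} (O₁-alpha , O₁-min) O₂-min Δ∘≤d₂ h =
    ≤-antisym (≮⇒≥ (no-excess h)) (≮⇒≥ (no-excess (α h) ∘ deficit⇒excess-α))
    where
    open CompareOrientations m (proj₁ O₁-alpha) (proj₁ shifted-alpha) (alpha-same-outdeg m O₁-alpha shifted-alpha)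

    no-excess : ∀ h → ¬ Excess h
    no-excess h excess with excess-closedTrail excess
    ... | k , z , trail , excesses =
      minimal⇒¬forward-and-reverse m {O₁} {O₂} O₁-min O₂-min trail (m<n⇒0<n ∘ excesses)
        (λ t → shifted-positive⇒positive Δ∘≤d₂ _ (m<n⇒0<n (excess⇒deficit-α (excesses (k ∸ t)))))

mainTheorem5 : (m : RootedBipartitePlaneMap) (d₁ d₂ : ℕ) →
    d₂ ≤ d₁ → MaxWhiteDegLE m d₂ →
    (O₁ O₂ : Fin (RootedBipartitePlaneMap.nH m) → ℕ) →
    IsMinimalAlphaOrientation m d₁ O₁ →
    IsMinimalAlphaOrientation m d₂ O₂ →
    ∀ h →
    (RootedBipartitePlaneMap.white m (RootedBipartitePlaneMap.vert m h) ≡ true → O₁ h ≡ O₂ h) ×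
    (RootedBipartitePlaneMap.white m (RootedBipartitePlaneMap.vert m h) ≡ false → O₁ h ≡ O₂ h + (d₁ ∸ d₂))
mainTheorem5 m d₁ d₂ d₂≤d₁ Δ∘≤d₂ O₁ O₂ O₁-minimal (O₂-alpha , O₂-min) h =
    (λ is-white → trans O₁≡shifted (trans (cong (λ w → O₂ h + shift w) is-white) (+-identityʳ (O₂ h))))
  , (λ is-black → trans O₁≡shifted (cong (λ w → O₂ h + shift w) is-black))
  where
  open Shifted m d₁ d₂ d₂≤d₁ O₂ O₂-alpha

  O₁≡shifted : O₁ h ≡ shifted h
  O₁≡shifted = minimal≡shifted O₁-minimal O₂-min Δ∘≤d₂ h
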